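{- Let $G$ be a quasi $5$-connected graph and $xy\in E(G)$. If the minimum degree of $G/xy$ is at least $4$, then $G/xy$ is $4$-connected.
   Context: All graphs are finite, simple and undirected. A cut of a connected graph $G$ is a set $T\subseteq V(G)$ such that $G-T$ is disconnected; a $k$-cut is a cut with $k$ elements. A $k$-cut $T$ is nontrivial if the components of $G-T$ can be partitioned into two subgraphs $G_{1},G_{2}$ with $|V(G_{1})|\geq 2$ and $|V(G_{2})|\geq 2$. A graph is quasi $k$-connected if it is $(k-1)$-connected and has no nontrivial $(k-1)$-cut. $G/xy$ is obtained by deleting the edge $xy$, identifying $x$ and $y$, and replacing multiple edges by single edges. -}

module Defs where

open import Data.Nat using (ℕ; suc; _<_; _≤_; pred)
open import Data.Bool using (Bool; true; false; not; _∧_; _∨_)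
open import Data.Fin using (Fin; punchIn; _≟_)
open import Data.Fin.Subset using (Subset; _∈_; _∉_; _⊆_; ∁; _∩_; ∣_∣)
open import Data.Vec using (tabulate)
open import Data.Product using (Σ; ∃; _×_)
open import Relation.Nullary using (¬_)
open import Relation.Nullary.Decidable using (⌊_⌋)
open import Relation.Binary.PropositionalEquality using (_≡_)

Graph : ℕ → Set
Graph n = Fin n → Fin n → Bool

Simple : ∀ {n} → Graph n → Set
Simple {n} G = (∀ (u v : Fin n) → G u v ≡ G v u) × (∀ (u : Fin n) → G u u ≡ false)

data Reach {n} (G : Graph n) (S : Subset n) : Fin n → Fin n → Set where
  here : ∀ {u} → u ∈ S → Reach G S u u
  step : ∀ {u v w} → u ∈ S → G u v ≡ true → Reach G S v w → Reach G S u w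

Disconnected-minus : ∀ {n} → Graph n → Subset n → Set
Disconnected-minus {n} G T =
  Σ (Fin n) λ u → Σ (Fin n) λ v → u ∉ T × v ∉ T × ¬ Reach G (∁ T) u v

IsCut : ∀ {n} → Graph n → Subset n → Set
IsCut G T = Disconnected-minus G T

KConnected : ℕ → ∀ {n} → Graph n → Set
KConnected k {n} G =
  k < n × (∀ (T : Subset n) → ∣ T ∣ < k →
             ∀ (u v : Fin n) → u ∉ T → v ∉ T → Reach G (∁ T) u v)

-- T is a nontrivial cut: T is a cut and the components of G - T split into
-- two parts each with at least 2 vertices. A part is given as a vertex set A
-- of G - T that is a union of components (closed under adjacency in G - T);
-- the other part is (V - T) - A.
NontrivialCut : ∀ {n} → Graph n → Subset n → Set
NontrivialCut {n} G T =
  IsCut G T ×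
  Σ (Subset n) λ A →
    A ⊆ ∁ T ×
    (∀ (u v : Fin n) → u ∈ A → v ∉ T → G u v ≡ true → v ∈ A) ×
    2 ≤ ∣ A ∣ × 2 ≤ ∣ ∁ T ∩ ∁ A ∣

QuasiConnected : ℕ → ∀ {n} → Graph n → Set
QuasiConnected k {n} G =
  KConnected (pred k) G ×
  (∀ (T : Subset n) → ∣ T ∣ ≡ pred k → ¬ NontrivialCut G T)

degree : ∀ {n} → Graph n → Fin n → ℕ
degree G v = ∣ tabulate (G v) ∣

-- Contraction G/xy, with vertex set V(G) - {y} identified with Fin m via
-- punchIn y; the merged vertex is represented by x.
contract : ∀ {m} → Graph (suc m) → Fin (suc m) → Fin (suc m) → Graph m
contract G x y i j =
  not ⌊ i ≟ j ⌋ ∧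
  (G a b ∨ (⌊ a ≟ x ⌋ ∧ G y b) ∨ (⌊ b ≟ x ⌋ ∧ G y a))
  where
  a = punchIn y i
  b = punchIn y j

module Submission where

-- Contracting xy maps walks of G that avoid a lift of T ⊆ V(G/xy) onto walks
-- of G/xy that avoid T, where the lift adds y exactly when T contains the
-- merged vertex. For |T| ≤ 3 the lift has at most three vertices, so G being
-- 4-connected suffices, unless T is a 3-set through the merged vertex. Then
-- the lift is a 4-cut of G whenever it separates two vertices u, v; both have
-- a neighbour outside T (degree ≥ 4 > |T|), and since T contains the merged
-- vertex these are edges of G itself, so the cut is nontrivial, contradicting
-- quasi 5-connectivity. Minimum degree 4 also forces G/xy to have ≥ 5 vertices.

open import Defs
open import Data.Nat using (ℕ; suc; zero; _≤_; _<_; _+_; s≤s)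
open import Data.Nat.Properties using (≤-trans; ≤-<-trans; <⇒≱; +-suc; +-monoˡ-≤; +-identityʳ; ≤-refl; m<1+n⇒m<n∨m≡n)
open import Data.Bool using (true; false; not; _∨_)
open import Data.Bool.Properties using (∨-zeroʳ; ∧-zeroʳ) renaming (_≟_ to _≟ᵇ_)
open import Data.Fin using (Fin; zero; suc; punchIn; punchOut; _≟_)
open import Data.Fin.Properties using (punchInᵢ≢i; punchIn-injective; punchIn-punchOut; punchOut-punchIn; punchOut-cong; any?)
open import Data.Fin.Subset using (Subset; _∈_; _∉_; _⊆_; _⊂_; ⊤; ∁; _∩_; ∣_∣; ⁅_⁆; _∪_; _-_)
open import Data.Fin.Subset.Properties using (_∈?_; ∣p∣≤n; ∣⊤∣≡n; ∈⊤; p⊂q⇒∣p∣<∣q∣; p⊆q⇒∣p∣≤∣q∣; p⊆p∪q; x∈p∪q⁺; x∈p∪q⁻; x∈⁅x⁆; x∈⁅y⁆⇒x≡y; ∣⁅x⁆∣≡1; x∈p∧x≢y⇒x∈p-y; x∈p⇒∣p-x∣<∣p∣; x∉p⇒x∈∁p; x∈∁p⇒x∉p; x∈p∩q⁺)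
open import Data.Vec using (_∷_; tabulate; insertAt)
open import Data.Vec.Properties using (lookup∘tabulate; []=⇒lookup; lookup⇒[]=; insertAt-lookup; insertAt-punchIn)
open import Data.Product using (Σ; ∃; _×_; _,_; proj₁; proj₂)
open import Data.Sum using (_⊎_; inj₁; inj₂)
open import Relation.Nullary using (¬_; Dec; yes; no; contradiction)
open import Relation.Nullary.Decidable using (⌊_⌋; _×-dec_; ¬?; dec-true; dec-false; isYes≗does)
open import Relation.Binary.PropositionalEquality using (_≡_; _≢_; refl; sym; trans; cong; subst; subst₂)

module _ {n} {G : Graph n} {S : Subset n} where

  Reach-source∈ : ∀ {a b} → Reach G S a b → a ∈ S
  Reach-source∈ (here a∈S) = a∈S
  Reach-source∈ (step a∈S _ _) = a∈S

  Reach-target∈ : ∀ {a b} → Reach G S a b → b ∈ S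
  Reach-target∈ (here b∈S) = b∈S
  Reach-target∈ (step _ _ r) = Reach-target∈ r

  Reach-snoc : ∀ {a b c} → Reach G S a b → G b c ≡ true → c ∈ S → Reach G S a c
  Reach-snoc (here b∈S) e c∈S = step b∈S e (here c∈S)
  Reach-snoc (step a∈S e′ r) e c∈S = step a∈S e′ (Reach-snoc r e c∈S)

  Closed : Subset n → Set
  Closed A = ∀ {a b} → a ∈ A → b ∈ S → G a b ≡ true → b ∈ A

  Closed-Reach : ∀ {A} → Closed A → ∀ {a b} → Reach G S a b → a ∈ A → b ∈ A
  Closed-Reach closed (here _) a∈A = a∈A
  Closed-Reach closed (step _ e r) a∈A = Closed-Reach closed r (closed a∈A (Reach-source∈ r) e)

  ExitsTo : Subset n → Fin n → Set
  ExitsTo A w = w ∈ S × w ∉ A × ∃ λ r → r ∈ A × G r w ≡ true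

  exit? : ∀ A → Dec (∃ (ExitsTo A))
  exit? A = any? λ w → (w ∈? S) ×-dec ¬? (w ∈? A) ×-dec any? (λ r → (r ∈? A) ×-dec (G r w ≟ᵇ true))

  no-exit⇒Closed : ∀ {A} → ¬ ∃ (ExitsTo A) → Closed A
  no-exit⇒Closed {A} no-exit {r} {w} r∈A w∈S e with w ∈? A
  ... | yes w∈A = w∈A
  ... | no w∉A = contradiction (w , w∈S , w∉A , r , r∈A , e) no-exit

  -- Each round adds a vertex, so n rounds (the fuel) suffice to reach a closed set.
  grow : ∀ {a} (fuel : ℕ) (A : Subset n) → n < ∣ A ∣ + fuel → a ∈ A →
         (∀ {w} → w ∈ A → Reach G S a w) →
         Σ (Subset n) λ C → a ∈ C × (∀ {w} → w ∈ C → Reach G S a w) × Closed C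
  grow zero A n<∣A∣ _ _ = contradiction (∣p∣≤n A) (<⇒≱ (subst (n <_) (+-identityʳ ∣ A ∣) n<∣A∣))
  grow {a} (suc fuel) A n<∣A∣+1+fuel a∈A reach with exit? A
  ... | no no-exit = A , a∈A , reach , no-exit⇒Closed no-exit
  ... | yes (w , w∈S , w∉A , r , r∈A , e) =
    grow fuel (A ∪ ⁅ w ⁆) n<∣A∪w∣+fuel (p⊆p∪q ⁅ w ⁆ a∈A) reach′
    where
    A⊂A∪w : A ⊂ A ∪ ⁅ w ⁆
    A⊂A∪w = p⊆p∪q ⁅ w ⁆ , w , x∈p∪q⁺ (inj₂ (x∈⁅x⁆ w)) , w∉A

    n<∣A∪w∣+fuel : n < ∣ A ∪ ⁅ w ⁆ ∣ + fuel
    n<∣A∪w∣+fuel = ≤-trans (subst (n <_) (+-suc ∣ A ∣ fuel) n<∣A∣+1+fuel)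
                           (+-monoˡ-≤ fuel (p⊂q⇒∣p∣<∣q∣ A⊂A∪w))

    reach′ : ∀ {v} → v ∈ A ∪ ⁅ w ⁆ → Reach G S a v
    reach′ v∈ with x∈p∪q⁻ A ⁅ w ⁆ v∈
    ... | inj₁ v∈A = reach v∈A
    ... | inj₂ v∈⁅w⁆ rewrite x∈⁅y⁆⇒x≡y w v∈⁅w⁆ = Reach-snoc (reach r∈A) e w∈S

  component : ∀ {a} → a ∈ S → Σ (Subset n) λ C →
              (∀ {w} → w ∈ C → Reach G S a w) × (∀ {w} → Reach G S a w → w ∈ C)
  component {a} a∈S with grow n ⁅ a ⁆ n<1+n (x∈⁅x⁆ a) reach-a
    where
    n<1+n : n < ∣ ⁅ a ⁆ ∣ + n
    n<1+n rewrite ∣⁅x⁆∣≡1 a = ≤-refl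

    reach-a : ∀ {w} → w ∈ ⁅ a ⁆ → Reach G S a w
    reach-a w∈⁅a⁆ rewrite x∈⁅y⁆⇒x≡y a w∈⁅a⁆ = here a∈S
  ... | C , a∈C , reach , closed = C , reach , λ r → Closed-Reach closed r a∈C

  Reach? : ∀ a b → Dec (Reach G S a b)
  Reach? a b with a ∈? S
  ... | no a∉S = no λ r → a∉S (Reach-source∈ r)
  ... | yes a∈S with component a∈S
  ...   | C , reach , reach⇒∈ with b ∈? C
  ...     | yes b∈C = yes (reach b∈C)
  ...     | no b∉C = no λ r → b∉C (reach⇒∈ r)

Reach-map : ∀ {n k} {G : Graph n} {H : Graph k} {S : Subset n} {S′ : Subset k}
            (f : Fin n → Fin k) → (∀ {a} → a ∈ S → f a ∈ S′) →
            (∀ {a b} → G a b ≡ true → f a ≡ f b ⊎ H (f a) (f b) ≡ true) →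
            ∀ {a b} → Reach G S a b → Reach H S′ (f a) (f b)
Reach-map f f-S f-E (here a∈S) = here (f-S a∈S)
Reach-map f f-S f-E (step a∈S e r) with f-E e
... | inj₁ fa≡fb rewrite fa≡fb = Reach-map f f-S f-E r
... | inj₂ fa~fb = step (f-S a∈S) fa~fb (Reach-map f f-S f-E r)

x∈p∧y∈p∧x≢y⇒2≤∣p∣ : ∀ {n} {p : Subset n} {x y} → x ∈ p → y ∈ p → x ≢ y → 2 ≤ ∣ p ∣
x∈p∧y∈p∧x≢y⇒2≤∣p∣ {p = p} {x} {y} x∈p y∈p x≢y = ≤-trans (s≤s 1≤∣p-x∣) (x∈p⇒∣p-x∣<∣p∣ x∈p)
  where
  ⁅y⁆⊆p-x : ⁅ y ⁆ ⊆ p - x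
  ⁅y⁆⊆p-x z∈⁅y⁆ rewrite x∈⁅y⁆⇒x≡y y z∈⁅y⁆ = x∈p∧x≢y⇒x∈p-y y∈p (λ y≡x → x≢y (sym y≡x))

  1≤∣p-x∣ : 1 ≤ ∣ p - x ∣
  1≤∣p-x∣ = subst (_≤ ∣ p - x ∣) (∣⁅x⁆∣≡1 y) (p⊆q⇒∣p∣≤∣q∣ ⁅y⁆⊆p-x)

-- The component of u in G - T and the rest of G - T are the two sides; each
-- side has two vertices because u and v each have a neighbour outside T.
separated⇒NontrivialCut : ∀ {n} {G : Graph n} {T : Subset n} {u v} → Simple G →
                          u ∉ T → v ∉ T → ¬ Reach G (∁ T) u v →
                          (∃ λ u′ → G u u′ ≡ true × u′ ∉ T) → (∃ λ v′ → G v v′ ≡ true × v′ ∉ T) →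
                          NontrivialCut G T
separated⇒NontrivialCut {G = G} {T} {u} {v} (symmetric , loopless)
                        u∉T v∉T u↛v (u′ , uu′ , u′∉T) (v′ , vv′ , v′∉T)
  with component (x∉p⇒x∈∁p u∉T)
... | C , reach , reach⇒∈ =
  (u , v , u∉T , v∉T , u↛v) , C , (λ w∈C → Reach-target∈ (reach w∈C)) , closed ,
  x∈p∧y∈p∧x≢y⇒2≤∣p∣ u∈C u′∈C (no-loop uu′) ,
  x∈p∧y∈p∧x≢y⇒2≤∣p∣ (x∈p∩q⁺ (x∉p⇒x∈∁p v∉T , x∉p⇒x∈∁p v∉C))
                    (x∈p∩q⁺ (x∉p⇒x∈∁p v′∉T , x∉p⇒x∈∁p v′∉C)) (no-loop vv′)
  where
  closed : ∀ a b → a ∈ C → b ∉ T → G a b ≡ true → b ∈ C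
  closed a b a∈C b∉T ab = reach⇒∈ (Reach-snoc (reach a∈C) ab (x∉p⇒x∈∁p b∉T))

  u∈C : u ∈ C
  u∈C = reach⇒∈ (here (x∉p⇒x∈∁p u∉T))

  u′∈C : u′ ∈ C
  u′∈C = closed u u′ u∈C u′∉T uu′

  v∉C : v ∉ C
  v∉C v∈C = u↛v (reach v∈C)

  v′∉C : v′ ∉ C
  v′∉C v′∈C = v∉C (closed v′ v v′∈C v∉T (trans (symmetric v′ v) vv′))

  no-loop : ∀ {a b} → G a b ≡ true → a ≢ b
  no-loop {a} ab refl with trans (sym ab) (loopless a)
  ... | ()

module _ {n} (T : Subset n) (y : Fin (suc n)) where

  punchIn∈insertAt⇒∈ : ∀ {b i} → punchIn y i ∈ insertAt T y b → i ∈ T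
  punchIn∈insertAt⇒∈ {b} {i} p =
    lookup⇒[]= i T (trans (sym (insertAt-punchIn T y b i)) ([]=⇒lookup p))

  ∈⇒punchIn∈insertAt : ∀ {b i} → i ∈ T → punchIn y i ∈ insertAt T y b
  ∈⇒punchIn∈insertAt {b} {i} p =
    lookup⇒[]= (punchIn y i) (insertAt T y b) (trans (insertAt-punchIn T y b i) ([]=⇒lookup p))

  y∈insertAt : y ∈ insertAt T y true
  y∈insertAt = lookup⇒[]= y (insertAt T y true) (insertAt-lookup T y true)


∣insertAt-true∣ : ∀ {n} (T : Subset n) y → ∣ insertAt T y true ∣ ≡ suc ∣ T ∣
∣insertAt-true∣ T zero = refl
∣insertAt-true∣ (true ∷ T) (suc y) = cong suc (∣insertAt-true∣ T y)
∣insertAt-true∣ (false ∷ T) (suc y) = ∣insertAt-true∣ T y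

∣insertAt-false∣ : ∀ {n} (T : Subset n) y → ∣ insertAt T y false ∣ ≡ ∣ T ∣
∣insertAt-false∣ T zero = refl
∣insertAt-false∣ (true ∷ T) (suc y) = cong suc (∣insertAt-false∣ T y)
∣insertAt-false∣ (false ∷ T) (suc y) = ∣insertAt-false∣ T y

module _ {n} (G : Graph n) where

  ∈neighbours⇒adjacent : ∀ {u w} → w ∈ tabulate (G u) → G u w ≡ true
  ∈neighbours⇒adjacent {u} {w} w∈ = trans (sym (lookup∘tabulate (G u) w)) ([]=⇒lookup w∈)

  ∣T∣<degree⇒neighbour∉T : ∀ (T : Subset n) u → ∣ T ∣ < degree G u →
                           ∃ λ w → G u w ≡ true × w ∉ T
  ∣T∣<degree⇒neighbour∉T T u ∣T∣<deg
    with any? (λ w → (G u w ≟ᵇ true) ×-dec ¬? (w ∈? T))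
  ... | yes neighbour = neighbour
  ... | no no-neighbour = contradiction (p⊆q⇒∣p∣≤∣q∣ neighbours⊆T) (<⇒≱ ∣T∣<deg)
    where
    neighbours⊆T : tabulate (G u) ⊆ T
    neighbours⊆T {w} w∈ with w ∈? T
    ... | yes w∈T = w∈T
    ... | no w∉T = contradiction (w , ∈neighbours⇒adjacent w∈ , w∉T) no-neighbour

  degree<n : (∀ u → G u u ≡ false) → ∀ u → degree G u < n
  degree<n loopless u = subst (degree G u <_) (∣⊤∣≡n n) (p⊂q⇒∣p∣<∣q∣ (neighbours⊆⊤ , u , ∈⊤ , u∉neighbours))
    where
    neighbours⊆⊤ : tabulate (G u) ⊆ ⊤
    neighbours⊆⊤ _ = ∈⊤

    u∉neighbours : u ∉ tabulate (G u)
    u∉neighbours u∈ with trans (sym (∈neighbours⇒adjacent u∈)) (loopless u)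
    ... | ()

⌊⌋-true : ∀ {a} {A : Set a} (a? : Dec A) → A → ⌊ a? ⌋ ≡ true
⌊⌋-true a? p = trans (isYes≗does a?) (dec-true a? p)

⌊⌋-false : ∀ {a} {A : Set a} (a? : Dec A) → ¬ A → ⌊ a? ⌋ ≡ false
⌊⌋-false a? ¬p = trans (isYes≗does a?) (dec-false a? ¬p)

≡-or-punchIn : ∀ {n} (y a : Fin (suc n)) → y ≡ a ⊎ ∃ λ i → punchIn y i ≡ a
≡-or-punchIn y a with y ≟ a
... | yes y≡a = inj₁ y≡a
... | no y≢a = inj₂ (punchOut y≢a , punchIn-punchOut y≢a)

module Contraction {m} (G : Graph (suc m)) (simple : Simple G)
                   (x y : Fin (suc m)) (xy : G x y ≡ true) where

  H : Graph m
  H = contract G x y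

  y≢x : y ≢ x
  y≢x y≡x with trans (sym xy) (subst (λ z → G x z ≡ false) (sym y≡x) (proj₂ simple x))
  ... | ()

  x′ : Fin m
  x′ = punchOut y≢x

  punchIn-x′ : punchIn y x′ ≡ x
  punchIn-x′ = punchIn-punchOut y≢x

  contract-loopless : ∀ i → H i i ≡ false
  contract-loopless i rewrite ⌊⌋-true (i ≟ i) refl = refl

  contract-adjacent : ∀ {i j} → i ≢ j →
                      G (punchIn y i) (punchIn y j) ≡ true ⊎
                      (punchIn y i ≡ x × G y (punchIn y j) ≡ true) ⊎
                      (punchIn y j ≡ x × G y (punchIn y i) ≡ true) →
                      H i j ≡ true
  contract-adjacent {i} {j} i≢j (inj₁ ab) rewrite ⌊⌋-false (i ≟ j) i≢j | ab = refl
  contract-adjacent {i} {j} i≢j (inj₂ (inj₁ (a≡x , yb)))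
    rewrite ⌊⌋-false (i ≟ j) i≢j | ⌊⌋-true (punchIn y i ≟ x) a≡x | yb = ∨-zeroʳ _
  contract-adjacent {i} {j} i≢j (inj₂ (inj₂ (b≡x , ya)))
    rewrite ⌊⌋-false (i ≟ j) i≢j | ⌊⌋-true (punchIn y j ≟ x) b≡x | ya =
    trans (cong (G (punchIn y i) (punchIn y j) ∨_) (∨-zeroʳ _)) (∨-zeroʳ _)

  contract-adjacent⁻ : ∀ {i j} → H i j ≡ true → punchIn y i ≢ x → punchIn y j ≢ x →
                       G (punchIn y i) (punchIn y j) ≡ true
  contract-adjacent⁻ {i} {j} ij a≢x b≢x
    rewrite ⌊⌋-false (punchIn y i ≟ x) a≢x | ⌊⌋-false (punchIn y j ≟ x) b≢x
    with G (punchIn y i) (punchIn y j)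
  ... | true = refl
  ... | false = trans (sym (∧-zeroʳ (not ⌊ i ≟ j ⌋))) ij

  merge : Fin (suc m) → Fin m
  merge a with y ≟ a
  ... | yes _ = x′
  ... | no y≢a = punchOut y≢a

  merge-y : merge y ≡ x′
  merge-y with y ≟ y
  ... | yes _ = refl
  ... | no y≢y = contradiction refl y≢y

  merge-punchIn : ∀ i → merge (punchIn y i) ≡ i
  merge-punchIn i with y ≟ punchIn y i
  ... | yes y≡pi = contradiction (sym y≡pi) (punchInᵢ≢i y i)
  ... | no _ = trans (punchOut-cong y refl) (punchOut-punchIn y)

  ≡-or-adjacent : ∀ {i j} → (i ≢ j → H i j ≡ true) → i ≡ j ⊎ H i j ≡ true
  ≡-or-adjacent {i} {j} adjacent with i ≟ j
  ... | yes i≡j = inj₁ i≡j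
  ... | no i≢j = inj₂ (adjacent i≢j)

  merge-adjacent : ∀ {a b} → G a b ≡ true → merge a ≡ merge b ⊎ H (merge a) (merge b) ≡ true
  merge-adjacent {a} {b} ab with ≡-or-punchIn y a | ≡-or-punchIn y b
  ... | inj₁ refl | inj₁ refl = contradiction (trans (sym ab) (proj₂ simple y)) λ ()
  ... | inj₁ refl | inj₂ (j , refl) rewrite merge-y | merge-punchIn j =
    ≡-or-adjacent λ x′≢j → contract-adjacent x′≢j (inj₂ (inj₁ (punchIn-x′ , ab)))
  ... | inj₂ (i , refl) | inj₁ refl rewrite merge-y | merge-punchIn i =
    ≡-or-adjacent λ i≢x′ → contract-adjacent i≢x′ (inj₂ (inj₂ (punchIn-x′ , trans (proj₁ simple y _) ab)))
  ... | inj₂ (i , refl) | inj₂ (j , refl) rewrite merge-punchIn i | merge-punchIn j =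
    ≡-or-adjacent λ i≢j → contract-adjacent i≢j (inj₁ ab)

  -- insertAt T y b lifts T ⊆ V(G/xy) to V(G); it contains the preimage of T
  -- under merge as long as b is true whenever T contains the merged vertex.
  merge-∉ : ∀ {T b a} → (x′ ∈ T → b ≡ true) → a ∉ insertAt T y b → merge a ∉ T
  merge-∉ {T} {b} {a} x′∈T⇒b a∉ with ≡-or-punchIn y a
  ... | inj₁ refl rewrite merge-y =
    λ x′∈T → a∉ (subst (λ b → y ∈ insertAt T y b) (sym (x′∈T⇒b x′∈T)) (y∈insertAt T y))
  ... | inj₂ (i , refl) rewrite merge-punchIn i = λ i∈T → a∉ (∈⇒punchIn∈insertAt T y i∈T)

  Reach-merge : ∀ {T b u v} → (x′ ∈ T → b ≡ true) →
                Reach G (∁ (insertAt T y b)) (punchIn y u) (punchIn y v) → Reach H (∁ T) u v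
  Reach-merge {T} x′∈T⇒b r =
    subst₂ (Reach H (∁ T)) (merge-punchIn _) (merge-punchIn _)
      (Reach-map merge (λ a∈ → x∉p⇒x∈∁p (merge-∉ x′∈T⇒b (x∈∁p⇒x∉p a∈))) merge-adjacent r)

  Reach-avoiding-small-lift : KConnected 4 G → ∀ {T b u v} → ∣ insertAt T y b ∣ < 4 →
                              (x′ ∈ T → b ≡ true) → u ∉ T → v ∉ T → Reach H (∁ T) u v
  Reach-avoiding-small-lift (_ , connected) {T} {b} {u} {v} ∣T′∣<4 x′∈T⇒b u∉T v∉T =
    Reach-merge x′∈T⇒b (connected (insertAt T y b) ∣T′∣<4 (punchIn y u) (punchIn y v)
      (λ p → u∉T (punchIn∈insertAt⇒∈ T y p)) (λ p → v∉T (punchIn∈insertAt⇒∈ T y p)))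

  punchIn≢x : ∀ {T i} → x′ ∈ T → i ∉ T → punchIn y i ≢ x
  punchIn≢x {T} x′∈T i∉T pi≡x =
    i∉T (subst (_∈ T) (punchIn-injective y x′ _ (trans punchIn-x′ (sym pi≡x))) x′∈T)

  lifted-neighbour∉ : ∀ {T u} → x′ ∈ T → u ∉ T → ∣ T ∣ < degree H u →
                      ∃ λ w → G (punchIn y u) w ≡ true × w ∉ insertAt T y true
  lifted-neighbour∉ {T} {u} x′∈T u∉T ∣T∣<deg with ∣T∣<degree⇒neighbour∉T H T u ∣T∣<deg
  ... | w , uw , w∉T =
    punchIn y w , contract-adjacent⁻ uw (punchIn≢x x′∈T u∉T) (punchIn≢x x′∈T w∉T) ,
    λ p → w∉T (punchIn∈insertAt⇒∈ T y p)

  Reach-avoiding-merged-3 : QuasiConnected 5 G → (∀ v → 4 ≤ degree H v) →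
                            ∀ {T u v} → x′ ∈ T → ∣ T ∣ ≡ 3 → u ∉ T → v ∉ T → Reach H (∁ T) u v
  Reach-avoiding-merged-3 (_ , no-nontrivial-4-cut) deg {T} {u} {v} x′∈T ∣T∣≡3 u∉T v∉T
    with Reach? {G = G} {S = ∁ (insertAt T y true)} (punchIn y u) (punchIn y v)
  ... | yes r = Reach-merge (λ _ → refl) r
  ... | no u↛v =
    contradiction
      (separated⇒NontrivialCut simple (λ p → u∉T (punchIn∈insertAt⇒∈ T y p))
        (λ p → v∉T (punchIn∈insertAt⇒∈ T y p)) u↛v
        (lifted-neighbour∉ x′∈T u∉T (∣T∣<deg u)) (lifted-neighbour∉ x′∈T v∉T (∣T∣<deg v)))
      (no-nontrivial-4-cut (insertAt T y true) (trans (∣insertAt-true∣ T y) (cong suc ∣T∣≡3)))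
    where
    ∣T∣<deg : ∀ w → ∣ T ∣ < degree H w
    ∣T∣<deg w rewrite ∣T∣≡3 = deg w

lemma3 : ∀ {m} (G : Graph (suc m)) → Simple G → QuasiConnected 5 G →
           ∀ (x y : Fin (suc m)) → G x y ≡ true →
           (∀ (v : Fin m) → 4 ≤ degree (contract G x y) v) →
           KConnected 4 (contract G x y)
lemma3 G simple quasi x y xy deg =
  ≤-<-trans (deg x′) (degree<n H contract-loopless x′) , connected
  where
  open Contraction G simple x y xy

  connected : ∀ T → ∣ T ∣ < 4 → ∀ u v → u ∉ T → v ∉ T → Reach H (∁ T) u v
  connected T ∣T∣<4 u v u∉T v∉T with x′ ∈? T | m<1+n⇒m<n∨m≡n ∣T∣<4
  ... | no x′∉T | _ =
    Reach-avoiding-small-lift (proj₁ quasi) (subst (_< 4) (sym (∣insertAt-false∣ T y)) ∣T∣<4)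
      (λ x′∈T → contradiction x′∈T x′∉T) u∉T v∉T
  ... | yes x′∈T | inj₁ ∣T∣<3 =
    Reach-avoiding-small-lift (proj₁ quasi) (subst (_< 4) (sym (∣insertAt-true∣ T y)) (s≤s ∣T∣<3))
      (λ _ → refl) u∉T v∉T
  ... | yes x′∈T | inj₂ ∣T∣≡3 = Reach-avoiding-merged-3 quasi deg x′∈T ∣T∣≡3 u∉T v∉T
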